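{- Let $n\ge 1$ and let $\mathcal{H}$ be an $n$-uniform linear hypergraph with exactly $n$ hyperedges $F_1,\dots,F_n$. Then, for any choice of the identifier spanning trees, the auxiliary graph of the first kind $G_1(\mathcal{H})$ admits a Vandermonde-completable orientation of its identifier edges.
   Context: A hypergraph is linear if any two distinct edges share at most one vertex; for $v\in V(\mathcal{H})$, $d(v)$ is the number of edges containing $v$. The auxiliary graph of the first kind $G_1(\mathcal{H})$ is the multigraph built as follows. For each $i=1,\dots,n$ take a copy $K_n^{(i)}$ of the complete graph $K_n$ (the $i$-th base clique) with vertices $v_{i,1},\dots,v_{i,n}$, whose vertices are labelled bijectively by the $n$ vertices of $F_i$; the base cliques are vertex-disjoint, so each $v\in V(\mathcal{H})$ labels exactly $d(v)$ vertices of $G_1(\mathcal{H})$. For each $v\in V(\mathcal{H})$ choose an arbitrary spanning tree (an identifier spanning tree) on the set of the $d(v)$ vertices labelled by $v$. For each edge of each identifier spanning tree, $G_1(\mathcal{H})$ contains $n-1$ parallel edges between its two endpoints; these are the identifier edges. The edge set of $G_1(\mathcal{H})$ consists of the edges of the base cliques together with the identifier edges. An orientation of the identifier edges is called Vandermonde-completable if the edges of the base cliques can be oriented so that each base clique becomes a transitive tournament and every vertex of the whole graph $G_1(\mathcal{H})$ has in-degree at most $n-1$. -}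

module Defs where

open import Data.Nat using (ℕ; zero; suc; _+_; _∸_; _≤_)
open import Data.Bool using (Bool; true; false; not; if_then_else_)
open import Data.Fin using (Fin; zero; suc; inject₁; fromℕ)
open import Data.Product using (_×_; _,_; Σ; ∃; ∃-syntax)
open import Relation.Binary.PropositionalEquality using (_≡_; _≢_)
open import Relation.Nullary using (¬_)
open import Function.Definitions using (Injective)

sumF : ∀ {m} → (Fin m → ℕ) → ℕ
sumF {zero}  f = 0
sumF {suc m} f = f zero + sumF (λ i → f (suc i))

countF : ∀ {m} → (Fin m → Bool) → ℕ
countF p = sumF (λ i → if p i then 1 else 0)

-- Hypergraph with n hyperedges F_1..F_n, each given with a bijective
-- labelling of the n vertices of the i-th base clique:
-- F i j = label of vertex v_{i,j}.  Injectivity of F i says F_i has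
-- exactly n vertices (n-uniform).

Linear : ∀ {n} {V : Set} → (Fin n → Fin n → V) → Set
Linear {n} F = ∀ (i j : Fin n) → i ≢ j → ∀ (a b c d : Fin n) →
  F i a ≡ F j c → F i b ≡ F j d → a ≡ b

Uniform : ∀ {n} {V : Set} → (Fin n → Fin n → V) → Set
Uniform {n} F = ∀ (i : Fin n) → Injective _≡_ _≡_ (F i)

-- Vertices of G₁(H): v_{i,j} ↦ (i , j)

GV : ℕ → Set
GV n = Fin n × Fin n

label : ∀ {n} {V : Set} → (Fin n → Fin n → V) → GV n → V
label F (i , j) = F i j

data Walk {X : Set} (A : X → X → Bool) : X → X → Set where
  here : ∀ {x} → Walk A x x
  step : ∀ {x y z} → A x y ≡ true → Walk A y z → Walk A x z

-- A cycle of length k+3: injective cyclic sequence of adjacent vertices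
Cycle : {X : Set} (A : X → X → Bool) → ℕ → Set
Cycle {X} A k = Σ (Fin (suc (suc (suc k))) → X) λ c →
  Injective _≡_ _≡_ c ×
  (∀ (i : Fin (suc (suc k))) → A (c (inject₁ i)) (c (suc i)) ≡ true) ×
  A (c (fromℕ (suc (suc k)))) (c zero) ≡ true

-- The union of the identifier spanning trees, as a simple graph A on
-- the vertices of G₁(H): every edge joins two vertices with the same
-- label, and for each v the graph restricted to the vertices labelled v
-- is a tree (connected and acyclic).  Since all edges stay within label
-- classes, a walk between equally-labelled vertices stays in the class,
-- and any cycle lies in one class.
IdentifierTrees : ∀ {n} {V : Set} → (Fin n → Fin n → V) →
  (GV n → GV n → Bool) → Set
IdentifierTrees {n} F A =
  (∀ x y → A x y ≡ A y x) ×
  (∀ x → A x x ≡ false) ×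
  (∀ x y → A x y ≡ true → label F x ≡ label F y) ×
  (∀ x y → label F x ≡ label F y → Walk A x y) ×
  (∀ k → ¬ Cycle A k)

-- Orientation of identifier edges: each tree edge {x,y} carries n-1
-- parallel copies indexed by Fin (n ∸ 1); dir x y k ≡ true means copy k
-- is oriented from x to y.

ValidOrientation : ∀ {n} → (GV n → GV n → Bool) →
  (GV n → GV n → Fin (n ∸ 1) → Bool) → Set
ValidOrientation A dir =
  ∀ x y → A x y ≡ true → ∀ k → dir x y k ≡ not (dir y x k)

idInDeg : ∀ {n} → (GV n → GV n → Bool) →
  (GV n → GV n → Fin (n ∸ 1) → Bool) → GV n → ℕ
idInDeg A dir y = sumF λ i → sumF λ j →
  if A (i , j) y then countF (dir (i , j) y) else 0

-- transitive tournament on Fin n: T a b ≡ true means edge oriented a → b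
TransitiveTournament : ∀ {n} → (Fin n → Fin n → Bool) → Set
TransitiveTournament {n} T =
  (∀ a → T a a ≡ false) ×
  (∀ a b → a ≢ b → T a b ≡ not (T b a)) ×
  (∀ a b c → T a b ≡ true → T b c ≡ true → T a c ≡ true)

VandermondeCompletable : ∀ {n} → (GV n → GV n → Bool) →
  (GV n → GV n → Fin (n ∸ 1) → Bool) → Set
VandermondeCompletable {n} A dir =
  Σ (Fin n → Fin n → Fin n → Bool) λ T → ((∀ (i : Fin n) → TransitiveTournament (T i)) ×
          (∀ (i b : Fin n) →
             countF (λ a → T i a b) + idInDeg A dir (i , b) ≤ n ∸ 1))

module Submission where

-- Number the n − 1 copies of each identifier edge by p = 1, …, n − 1 and read clique indices
-- cyclically.  Copy p orients every identifier tree away from its root, the vertex of the tree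
-- whose clique comes first walking forward from clique p; a vertex then receives at most one
-- copy-p edge (two would close a cycle through it), and none if it is the root.  Let gap y be
-- the cyclic distance from the nearest other clique carrying the label of y back to the clique
-- of y (n if there is none); y is the root for exactly gap y values of p.  By linearity, two
-- vertices of a base clique with the same gap below n coincide, so ordering each base clique by
-- gap is a transitive tournament in which y has in-degree at most gap y − 1, which is at most
-- the number of copies p ≥ 1 rooted at y.  Charging each tournament edge into y to such a
-- copy, every copy p ≥ 1 accounts for at most one edge into y.

open import Defs
open import Data.Bool using (Bool; true; false; not; _∧_; if_then_else_)
import Data.Bool.Properties as Boolₚ
open import Data.Empty using (⊥-elim)
open import Data.Fin using (Fin; zero; suc; toℕ; fromℕ; fromℕ<; inject₁; combine)
import Data.Fin.Properties as Finₚ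
open import Data.List using (List; []; _∷_; map; filter; cartesianProduct; allFin)
open import Data.List.Membership.Propositional using (_∈_)
open import Data.List.Membership.Propositional.Properties
  using (∈-cartesianProduct⁺; ∈-allFin; ∈-filter⁺; ∈-filter⁻; ∈-map⁺; ∈-map⁻)
import Data.List.Membership.DecPropositional as DecMembership
open import Data.List.Relation.Binary.Subset.Propositional using (_⊆_)
open import Data.List.Relation.Unary.All using (All; []; _∷_)
import Data.List.Relation.Unary.All as All
open import Data.List.Relation.Unary.All.Properties using (anti-mono; ¬Any⇒All¬)
open import Data.List.Relation.Unary.AllPairs using ([]; _∷_)
open import Data.List.Relation.Unary.Any using (here; there)
open import Data.List.Relation.Unary.Unique.Propositional using (Unique)
open import Data.Nat using (ℕ; zero; suc; _+_; _*_; _∸_; _≤_; _<_; z≤n; s≤s; _≟_; _≤?_; _<?_)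
open import Data.Nat.Properties
open import Algebra.Properties.CommutativeSemigroup +-commutativeSemigroup using (interchange; xy∙z≈xz∙y)
open import Data.List.Extrema ≤-totalOrder
  using (argmin; argmin-all; argmin-sel; f[argmin]≤f[xs]; min; min≤⊤; v≤min⁺)
open import Data.Product using (∃; ∃-syntax; Σ; _×_; _,_; proj₁; proj₂)
open import Data.Product.Properties using (≡-dec)
open import Data.Product.Relation.Binary.Lex.Strict using (×-strictTotalOrder)
open import Data.Sum using (_⊎_; inj₁; inj₂)
open import Function.Definitions using (Injective)
open import Level using (0ℓ)
open import Relation.Binary.Bundles using (StrictTotalOrder)
open import Relation.Binary.Definitions using (DecidableEquality; tri<; tri≈; tri>)
open import Relation.Binary.PropositionalEquality
open import Relation.Nullary using (Dec; yes; no; ¬_; does; contradiction; _×-dec_; ¬?; map′)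
open import Relation.Nullary.Decidable using (dec-true; dec-false)
open import Relation.Unary using (Decidable)

does⇒ : ∀ {P : Set} (p? : Dec P) → does p? ≡ true → P
does⇒ (yes p) _ = p

∧-true⁻ : ∀ {b c} → b ∧ c ≡ true → b ≡ true × c ≡ true
∧-true⁻ {true} {true} _ = refl , refl

sumF-cong : ∀ {m} {f g : Fin m → ℕ} → (∀ i → f i ≡ g i) → sumF f ≡ sumF g
sumF-cong {zero}  f≡g = refl
sumF-cong {suc m} f≡g = cong₂ _+_ (f≡g zero) (sumF-cong (λ i → f≡g (suc i)))

sumF-mono-≤ : ∀ {m} {f g : Fin m → ℕ} → (∀ i → f i ≤ g i) → sumF f ≤ sumF g
sumF-mono-≤ {zero}  f≤g = z≤n
sumF-mono-≤ {suc m} f≤g = +-mono-≤ (f≤g zero) (sumF-mono-≤ (λ i → f≤g (suc i)))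

sumF-distrib-+ : ∀ {m} (f g : Fin m → ℕ) → sumF (λ i → f i + g i) ≡ sumF f + sumF g
sumF-distrib-+ {zero}  f g = refl
sumF-distrib-+ {suc m} f g = trans
  (cong (f zero + g zero +_) (sumF-distrib-+ (λ i → f (suc i)) (λ i → g (suc i))))
  (interchange (f zero) (g zero) _ _)

sumF-zero : ∀ m → sumF {m} (λ _ → 0) ≡ 0
sumF-zero zero    = refl
sumF-zero (suc m) = sumF-zero m

sumF-one : ∀ m → sumF {m} (λ _ → 1) ≡ m
sumF-one zero    = refl
sumF-one (suc m) = cong suc (sumF-one m)

sumF-comm : ∀ {m k} (h : Fin m → Fin k → ℕ) →
  sumF (λ i → sumF (h i)) ≡ sumF (λ j → sumF (λ i → h i j))
sumF-comm {zero}  {k} h = sym (sumF-zero k)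
sumF-comm {suc m}     h = trans
  (cong (sumF (h zero) +_) (sumF-comm (λ i → h (suc i))))
  (sym (sumF-distrib-+ (h zero) (λ j → sumF (λ i → h (suc i) j))))

f≤sumF : ∀ {m} (f : Fin m → ℕ) i → f i ≤ sumF f
f≤sumF f zero    = m≤m+n _ _
f≤sumF f (suc i) = ≤-trans (f≤sumF (λ j → f (suc j)) i) (m≤n+m _ (f zero))

sumF-≤1 : ∀ {m} (f : Fin m → ℕ) → (∀ i → f i ≤ 1) →
  (∀ i j → 1 ≤ f i → 1 ≤ f j → i ≡ j) → sumF f ≤ 1
sumF-≤1 {zero}  f f≤1 unique = z≤n
sumF-≤1 {suc m} f f≤1 unique with f zero | f≤1 zero | unique zero
... | 0 | _ | _ = sumF-≤1 (λ i → f (suc i)) (λ i → f≤1 (suc i))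
  (λ i j fi fj → Finₚ.suc-injective (unique (suc i) (suc j) fi fj))
... | 1 | _ | unique₀ = ≤-reflexive (cong suc (trans
  (sumF-cong (λ i → n≤0⇒n≡0 (≮⇒≥ (λ 1≤fi → contradiction (unique₀ (suc i) ≤-refl 1≤fi) λ ()))))
  (sumF-zero m)))
... | suc (suc _) | s≤s () | _

indicator : Bool → ℕ
indicator b = if b then 1 else 0

indicator≤1 : ∀ b → indicator b ≤ 1
indicator≤1 true  = ≤-refl
indicator≤1 false = z≤n

countF-≤ : ∀ {m} (p : Fin m → Bool) → countF p ≤ m
countF-≤ {m} p = ≤-trans (sumF-mono-≤ (λ i → indicator≤1 (p i))) (≤-reflexive (sumF-one m))

indicator-<-fibres : ∀ G x → indicator (does (x <? G)) ≡ countF {G} (λ t → does (toℕ t ≟ x))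
indicator-<-fibres zero    x       = refl
indicator-<-fibres (suc G) zero    = cong suc (sym (sumF-zero G))
indicator-<-fibres (suc G) (suc x) = indicator-<-fibres G x

indicator⇒ : ∀ {b} → 1 ≤ indicator b → b ≡ true
indicator⇒ {true} _ = refl

countF-≤1 : ∀ {m} (p : Fin m → Bool) → (∀ i j → p i ≡ true → p j ≡ true → i ≡ j) → countF p ≤ 1
countF-≤1 p unique = sumF-≤1 _ (λ i → indicator≤1 (p i))
  (λ i j pi pj → unique i j (indicator⇒ pi) (indicator⇒ pj))

countF-witness : ∀ {m} (p : Fin m → Bool) → 1 ≤ countF p → ∃ λ i → p i ≡ true
countF-witness {suc m} p 1≤count with p zero in p₀
... | true  = zero , p₀
... | false with countF-witness (λ i → p (suc i)) 1≤count
...   | i , pi = suc i , pi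

countF-pairs-≤1 : ∀ {m k} (p : Fin m → Fin k → Bool) →
  (∀ i j i′ j′ → p i j ≡ true → p i′ j′ ≡ true → (i , j) ≡ (i′ , j′)) →
  sumF (λ i → countF (p i)) ≤ 1
countF-pairs-≤1 p unique = sumF-≤1 _
  (λ i → countF-≤1 (p i) (λ j j′ pj pj′ → cong proj₂ (unique i j i j′ pj pj′)))
  (λ i i′ 1≤ci 1≤ci′ →
    let (j , pj) = countF-witness (p i) 1≤ci ; (j′ , pj′) = countF-witness (p i′) 1≤ci′
    in cong proj₁ (unique i j i′ j′ pj pj′))

1≤countF : ∀ {m} (p : Fin m → Bool) i → p i ≡ true → 1 ≤ countF p
1≤countF p i pi = ≤-trans (≤-reflexive (cong indicator (sym pi))) (f≤sumF _ i)

countF-<-fibres : ∀ {k} (f : Fin k → ℕ) G →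
  countF (λ a → does (f a <? G)) ≡ sumF {G} (λ t → countF (λ a → does (toℕ t ≟ f a)))
countF-<-fibres {k} f G = trans (sumF-cong {k} (λ a → indicator-<-fibres G (f a)))
  (sumF-comm {k} {G} (λ a t → indicator (does (toℕ t ≟ f a))))

surjective⇒≤countF-< : ∀ {k} (f : Fin k → ℕ) G → (∀ t → t < G → ∃ λ a → f a ≡ t) →
  G ≤ countF (λ a → does (f a <? G))
surjective⇒≤countF-< f G onto = begin
  G                                                   ≡⟨ sym (sumF-one G) ⟩
  sumF {G} (λ _ → 1)                                  ≤⟨ sumF-mono-≤ hit ⟩
  sumF {G} (λ t → countF (λ a → does (toℕ t ≟ f a)))  ≡⟨ sym (countF-<-fibres f G) ⟩
  countF (λ a → does (f a <? G))                      ∎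
  where
  open ≤-Reasoning
  hit : ∀ (t : Fin G) → 1 ≤ countF (λ a → does (toℕ t ≟ f a))
  hit t = let (a , fa≡t) = onto (toℕ t) (Finₚ.toℕ<n t)
          in 1≤countF _ a (dec-true (toℕ t ≟ f a) (sym fa≡t))

injective⇒countF-<≤pred : ∀ {k} (f : Fin k → ℕ) G → (∀ a → 1 ≤ f a) →
  (∀ a b → f a ≡ f b → f a < G → a ≡ b) → countF (λ a → does (f a <? G)) ≤ G ∸ 1
injective⇒countF-<≤pred f zero    f≥1 inj = ≤-reflexive (countF-<-fibres f zero)
injective⇒countF-<≤pred {k} f (suc G) f≥1 inj = begin
  countF (λ a → does (f a <? suc G))                         ≡⟨ countF-<-fibres f (suc G) ⟩
  countF (λ a → does (0 ≟ f a)) + sumF (λ t → fibre (suc t)) ≡⟨ cong (_+ sumF (λ t → fibre (suc t))) no-zero ⟩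
  sumF (λ t → fibre (suc t))                                 ≤⟨ sumF-mono-≤ fibre≤1 ⟩
  sumF {G} (λ _ → 1)                                         ≡⟨ sumF-one G ⟩
  G                                                          ∎
  where
  open ≤-Reasoning
  fibre : Fin (suc G) → ℕ
  fibre t = countF (λ a → does (toℕ t ≟ f a))
  no-zero : countF (λ a → does (0 ≟ f a)) ≡ 0
  no-zero = trans (sumF-cong (λ a → cong indicator (dec-false (0 ≟ f a) (<⇒≢ (f≥1 a))))) (sumF-zero k)
  fibre≤1 : ∀ (t : Fin G) → fibre (suc t) ≤ 1
  fibre≤1 t = countF-≤1 _ (λ a b ta tb →
    let fa≡t = sym (does⇒ (_ ≟ f a) ta) ; fb≡t = sym (does⇒ (_ ≟ f b) tb)
    in inj a b (trans fa≡t (sym fb≡t)) (subst (_< suc G) (sym fa≡t) (s≤s (Finₚ.toℕ<n t))))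

countF-mono : ∀ {m} {p q : Fin m → Bool} → (∀ i → p i ≡ true → q i ≡ true) → countF p ≤ countF q
countF-mono {p = p} {q} p⇒q = sumF-mono-≤ λ i → indicator-mono (p i) (q i) (p⇒q i)
  where indicator-mono : ∀ b c → (b ≡ true → c ≡ true) → indicator b ≤ indicator c
        indicator-mono false c       _   = z≤n
        indicator-mono true  c       b⇒c rewrite b⇒c refl = ≤-refl

countF-≤-missing : ∀ {m} (p : Fin (suc m) → Bool) b → p b ≡ false → countF p ≤ m
countF-≤-missing {m} p zero pb rewrite pb = countF-≤ (λ i → p (suc i))
countF-≤-missing {suc m} p (suc b) pb =
  +-mono-≤ (indicator≤1 (p zero)) (countF-≤-missing (λ i → p (suc i)) b pb)

least : (ℕ → Bool) → ℕ → ℕ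
least p zero    = 0
least p (suc B) = if p 0 then 0 else suc (least (λ t → p (suc t)) B)

least-holds : ∀ (p : ℕ → Bool) B {t} → t ≤ B → p t ≡ true → p (least p B) ≡ true
least-holds p zero    z≤n pt = pt
least-holds p (suc B) {zero} _ pt rewrite pt = pt
least-holds p (suc B) {suc t} (s≤s t≤B) pt with p 0 in p0
... | true  = p0
... | false = least-holds (λ t → p (suc t)) B t≤B pt

least-minimal : ∀ (p : ℕ → Bool) B {t} → p t ≡ true → least p B ≤ t
least-minimal p zero    pt = z≤n
least-minimal p (suc B) {zero} pt rewrite pt = z≤n
least-minimal p (suc B) {suc t} pt with p 0
... | true  = z≤n
... | false = s≤s (least-minimal (λ t → p (suc t)) B pt)

least≤ : ∀ (p : ℕ → Bool) B → least p B ≤ B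
least≤ p zero    = z≤n
least≤ p (suc B) with p 0
... | true  = z≤n
... | false = s≤s (least≤ (λ t → p (suc t)) B)

module Precedence (S : StrictTotalOrder 0ℓ 0ℓ 0ℓ) where
  open StrictTotalOrder S using (_≈_; compare; irrefl; asym; module Eq)
    renaming (Carrier to K; _<_ to _≺_; _<?_ to _≺?_; trans to ≺-trans)

  precedes : {X : Set} → (X → K) → X → X → Bool
  precedes key x y = does (key x ≺? key y)

  module _ {X : Set} (key : X → K) where

    precedes⇒≺ : ∀ x y → precedes key x y ≡ true → key x ≺ key y
    precedes⇒≺ x y = does⇒ (key x ≺? key y)

    precedes-irrefl : ∀ x → precedes key x x ≡ false
    precedes-irrefl x = dec-false (key x ≺? key x) (irrefl Eq.refl)

    precedes-trans : ∀ x y z → precedes key x y ≡ true → precedes key y z ≡ true →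
      precedes key x z ≡ true
    precedes-trans x y z x≺y y≺z =
      dec-true (key x ≺? key z) (≺-trans (precedes⇒≺ x y x≺y) (precedes⇒≺ y z y≺z))

    precedes-flip : ∀ x y → ¬ key x ≈ key y → precedes key x y ≡ not (precedes key y x)
    precedes-flip x y x≉y with key x ≺? key y | key y ≺? key x
    ... | yes _   | no _    = refl
    ... | no _    | yes _   = refl
    ... | yes x≺y | yes y≺x = contradiction y≺x (asym x≺y)
    ... | no x⊀y  | no y⊀x  with compare (key x) (key y)
    ...   | tri< x≺y _ _ = contradiction x≺y x⊀y
    ...   | tri≈ _ x≈y _ = contradiction x≈y x≉y
    ...   | tri> _ _ y≺x = contradiction y≺x y⊀x

  precedes-transitiveTournament : ∀ {n} (key : Fin n → K) → (∀ a b → key a ≈ key b → a ≡ b) →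
    TransitiveTournament (precedes key)
  precedes-transitiveTournament key injective =
    precedes-irrefl key ,
    (λ a b a≢b → precedes-flip key a b (λ ka≈kb → a≢b (injective a b ka≈kb))) ,
    precedes-trans key

module CyclicDistance (n : ℕ) where

  data Forward (a t b : ℕ) : Set where
    direct  : a + t ≡ b     → Forward a t b
    wrapped : a + t ≡ b + n → Forward a t b

  dist : ℕ → ℕ → ℕ
  dist a b with a ≤? b
  ... | yes _ = b ∸ a
  ... | no  _ = b + n ∸ a

  forward-dist : ∀ {a} b → a < n → Forward a (dist a b) b
  forward-dist {a} b a<n with a ≤? b
  ... | yes a≤b = direct (m+[n∸m]≡n a≤b)
  ... | no  a≰b = wrapped (m+[n∸m]≡n (≤-trans (<⇒≤ a<n) (m≤n+m n b)))

  dist<n : ∀ {a b} → a < n → b < n → dist a b < n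
  dist<n {a} {b} a<n b<n with a ≤? b
  ... | yes _   = ≤-<-trans (m∸n≤m b a) b<n
  ... | no  a≰b = subst (b + n ∸ a <_) (m+n∸m≡n a n)
    (∸-monoˡ-< (+-monoˡ-< n (≰⇒> a≰b)) (≤-trans (<⇒≤ a<n) (m≤n+m n b)))

  forward-comm : ∀ {a t b} → Forward a t b → Forward t a b
  forward-comm {a} {t} (direct eq) = direct (trans (+-comm t a) eq)
  forward-comm {a} {t} (wrapped eq) = wrapped (trans (+-comm t a) eq)

  forward-unique : ∀ {a t t′ b} → t < n → t′ < n → Forward a t b → Forward a t′ b → t ≡ t′
  forward-unique _ _ (direct eq) (direct eq′) = +-cancelˡ-≡ _ _ _ (trans eq (sym eq′))
  forward-unique _ _ (wrapped eq) (wrapped eq′) = +-cancelˡ-≡ _ _ _ (trans eq (sym eq′))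
  forward-unique {a} {t} {t′} {b} _ t′<n (direct eq) (wrapped eq′) =
    contradiction t′<n (≤⇒≯ (+-cancelˡ-≤ (a + t) n t′ (begin
      a + t + n  ≡⟨ cong (_+ n) eq ⟩
      b + n      ≡⟨ eq′ ⟨
      a + t′     ≤⟨ +-monoˡ-≤ t′ (m≤m+n a t) ⟩
      a + t + t′ ∎)))
    where open ≤-Reasoning
  forward-unique t<n t′<n eq@(wrapped _) eq′@(direct _) = sym (forward-unique t′<n t<n eq′ eq)

  dist-unique : ∀ {a b t} → a < n → b < n → t < n → Forward a t b → dist a b ≡ t
  dist-unique {b = b} a<n b<n t<n fwd = forward-unique (dist<n a<n b<n) t<n (forward-dist b a<n) fwd

  dist-injectiveˡ : ∀ {a a′ b} → a < n → a′ < n → b < n → dist a b ≡ dist a′ b → a ≡ a′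
  dist-injectiveˡ {a} {a′} {b} a<n a′<n b<n eq = forward-unique a<n a′<n
    (forward-comm (forward-dist b a<n))
    (subst (λ t → Forward t a′ b) (sym eq) (forward-comm (forward-dist b a′<n)))

  dist-surjectiveˡ : ∀ {b t} → b < n → t < n → ∃ λ a → a < n × dist a b ≡ t
  dist-surjectiveˡ {b} {t} b<n t<n =
    dist t b , dist<n t<n b<n , dist-unique (dist<n t<n b<n) b<n t<n (forward-comm (forward-dist b t<n))

  dist≡0⇒≡ : ∀ {a b} → a < n → dist a b ≡ 0 → a ≡ b
  dist≡0⇒≡ {a} {b} a<n d≡0 with forward-dist b a<n
  ... | direct eq = trans (sym (+-identityʳ a)) (trans (cong (a +_) (sym d≡0)) eq)
  ... | wrapped eq = contradiction a<n (≤⇒≯ (begin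
    n            ≤⟨ m≤n+m n b ⟩
    b + n        ≡⟨ eq ⟨
    a + dist a b ≡⟨ cong (a +_) d≡0 ⟩
    a + 0        ≡⟨ +-identityʳ a ⟩
    a            ∎))
    where open ≤-Reasoning

  private
    shift : ∀ {p x z u v} → x ≤ z → p + x ≡ u → p + z ≡ v → u + (z ∸ x) ≡ v
    shift {p} {x} {z} {u} {v} x≤z px pz = begin
      u + (z ∸ x)       ≡⟨ cong (_+ (z ∸ x)) px ⟨
      p + x + (z ∸ x)   ≡⟨ +-assoc p x (z ∸ x) ⟩
      p + (x + (z ∸ x)) ≡⟨ cong (p +_) (m+[n∸m]≡n x≤z) ⟩
      p + z             ≡⟨ pz ⟩
      v                 ∎
      where open ≡-Reasoning

  forward-split : ∀ {p x z j i} → i < n → x ≤ z → Forward p x j → Forward p z i → Forward j (z ∸ x) i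
  forward-split i<n x≤z (direct px) (direct pz) = direct (shift x≤z px pz)
  forward-split i<n x≤z (direct px) (wrapped pz) = wrapped (shift x≤z px pz)
  forward-split {x = x} {z} {j} {i} i<n x≤z (wrapped px) (direct pz) =
    contradiction i<n (≤⇒≯ (begin
      n               ≤⟨ m≤n+m n j ⟩
      j + n           ≤⟨ m≤m+n (j + n) (z ∸ x) ⟩
      j + n + (z ∸ x) ≡⟨ shift x≤z px pz ⟩
      i               ∎))
    where open ≤-Reasoning
  forward-split {x = x} {z} {j} i<n x≤z (wrapped px) (wrapped pz) =
    direct (+-cancelʳ-≡ n _ _ (trans (xy∙z≈xz∙y j (z ∸ x) n) (shift x≤z px pz)))

  dist-split : ∀ {p j i} → p < n → j < n → i < n → dist p j ≤ dist p i → dist p j + dist j i ≡ dist p i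
  dist-split {p} {j} {i} p<n j<n i<n x≤z = begin
    dist p j + dist j i ≡⟨ cong (dist p j +_) (dist-unique j<n i<n z∸x<n
                             (forward-split i<n x≤z (forward-dist j p<n) (forward-dist i p<n))) ⟩
    dist p j + (dist p i ∸ dist p j) ≡⟨ m+[n∸m]≡n x≤z ⟩
    dist p i ∎
    where
    open ≡-Reasoning
    z∸x<n : dist p i ∸ dist p j < n
    z∸x<n = ≤-<-trans (m∸n≤m (dist p i) (dist p j)) (dist<n p<n i<n)

  forward-injective : ∀ {a t b b′} → b < n → b′ < n → Forward a t b → Forward a t b′ → b ≡ b′
  forward-injective _ _ (direct eq)  (direct eq′)  = trans (sym eq) eq′
  forward-injective _ _ (wrapped eq) (wrapped eq′) = +-cancelʳ-≡ n _ _ (trans (sym eq) eq′)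
  forward-injective {b = b} {b′} b<n _ (direct eq) (wrapped eq′) =
    contradiction b<n (≤⇒≯ (≤-trans (m≤n+m n b′) (≤-reflexive (trans (sym eq′) eq))))
  forward-injective b<n b′<n eq@(wrapped _) eq′@(direct _) = sym (forward-injective b′<n b<n eq′ eq)

  dist-injectiveʳ : ∀ {a b b′} → a < n → b < n → b′ < n → dist a b ≡ dist a b′ → b ≡ b′
  dist-injectiveʳ {a} {b} {b′} a<n b<n b′<n eq = forward-injective b<n b′<n
    (forward-dist b a<n) (subst (λ t → Forward a t b′) (sym eq) (forward-dist b′ a<n))

module WalkProperties {X : Set} (A : X → X → Bool) where

  vertices : ∀ {x y} → Walk A x y → List X
  vertices {x} here       = x ∷ []
  vertices {x} (step _ w) = x ∷ vertices w

  length : ∀ {x y} → Walk A x y → ℕ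
  length here       = 0
  length (step _ w) = suc (length w)

  _++ᵂ_ : ∀ {x y z} → Walk A x y → Walk A y z → Walk A x z
  here     ++ᵂ w′ = w′
  step a w ++ᵂ w′ = step a (w ++ᵂ w′)

  All-++ᵂ : ∀ {P : X → Set} {x y z} (w : Walk A x y) (w′ : Walk A y z) →
    All P (vertices w) → All P (vertices w′) → All P (vertices (w ++ᵂ w′))
  All-++ᵂ here       w′ _          pw′ = pw′
  All-++ᵂ (step a w) w′ (px ∷ pw) pw′ = px ∷ All-++ᵂ w w′ pw pw′

  All-first : ∀ {P : X → Set} {x y} (w : Walk A x y) → All P (vertices w) → P x
  All-first here       (px ∷ _) = px
  All-first (step _ w) (px ∷ _) = px

  module Reverse (A-sym : ∀ x y → A x y ≡ A y x) where

    reverse : ∀ {x y} → Walk A x y → Walk A y x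
    reverse here                = here
    reverse (step {x} {y} a w) = reverse w ++ᵂ step (trans (A-sym y x) a) here

    All-reverse : ∀ {P : X → Set} {x y} (w : Walk A x y) → All P (vertices w) → All P (vertices (reverse w))
    All-reverse here       pw        = pw
    All-reverse (step a w) (px ∷ pw) = All-++ᵂ (reverse w) _ (All-reverse w pw) (All-first w pw ∷ px ∷ [])

  vertexAt : ∀ {x y} (w : Walk A x y) → Fin (suc (length w)) → X
  vertexAt {x} here       zero    = x
  vertexAt {x} (step _ w) zero    = x
  vertexAt     (step _ w) (suc i) = vertexAt w i

  vertexAt-first : ∀ {x y} (w : Walk A x y) → vertexAt w zero ≡ x
  vertexAt-first here       = refl
  vertexAt-first (step _ w) = refl

  vertexAt-last : ∀ {x y} (w : Walk A x y) → vertexAt w (fromℕ (length w)) ≡ y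
  vertexAt-last here       = refl
  vertexAt-last (step _ w) = vertexAt-last w

  vertexAt-adjacent : ∀ {x y} (w : Walk A x y) (i : Fin (length w)) →
    A (vertexAt w (inject₁ i)) (vertexAt w (suc i)) ≡ true
  vertexAt-adjacent (step {x} a w) zero    = subst (λ v → A x v ≡ true) (sym (vertexAt-first w)) a
  vertexAt-adjacent (step a w)     (suc i) = vertexAt-adjacent w i

  vertexAt-∈ : ∀ {x y} (w : Walk A x y) i → vertexAt w i ∈ vertices w
  vertexAt-∈ here       zero    = here refl
  vertexAt-∈ (step _ w) zero    = here refl
  vertexAt-∈ (step _ w) (suc i) = there (vertexAt-∈ w i)

  vertexAt-injective : ∀ {x y} (w : Walk A x y) → Unique (vertices w) → Injective _≡_ _≡_ (vertexAt w)
  vertexAt-injective here       _          {zero}  {zero}  _  = refl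
  vertexAt-injective (step _ w) _          {zero}  {zero}  _  = refl
  vertexAt-injective (step _ w) (x∉ ∷ _)   {zero}  {suc j} eq =
    ⊥-elim (All.lookup x∉ (subst (_∈ vertices w) (sym eq) (vertexAt-∈ w j)) refl)
  vertexAt-injective (step _ w) (x∉ ∷ _)   {suc i} {zero}  eq =
    ⊥-elim (All.lookup x∉ (subst (_∈ vertices w) eq (vertexAt-∈ w i)) refl)
  vertexAt-injective (step _ w) (_ ∷ uniq) {suc i} {suc j} eq = cong suc (vertexAt-injective w uniq eq)

  SimpleWalk : X → X → List X → Set
  SimpleWalk x y S = Σ (Walk A x y) λ w → Unique (vertices w) × vertices w ⊆ S

  length<  : ∀ {N} (index : X → Fin N) → Injective _≡_ _≡_ index →
    ∀ {x y} (w : Walk A x y) → Unique (vertices w) → length w < N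
  length< {N} index index-injective w unique with suc (length w) ≤? N
  ... | yes w<N = w<N
  ... | no  w≮N with Finₚ.pigeonhole (≰⇒> w≮N) (λ i → index (vertexAt w i))
  ...   | i , j , i<j , eq = contradiction
          (vertexAt-injective w unique (index-injective eq)) (λ i≡j → <-irrefl (cong toℕ i≡j) i<j)

  closeCycle : ∀ {x y} (w : Walk A y x) → 2 ≤ length w → Unique (vertices w) → A x y ≡ true → ∃ (Cycle A)
  closeCycle w@(step _ (step _ _)) _ unique closing =
    _ , vertexAt w , vertexAt-injective w unique , vertexAt-adjacent w ,
    subst₂ (λ u v → A u v ≡ true) (sym (vertexAt-last w)) (sym (vertexAt-first w)) closing
  closeCycle (step _ here) (s≤s ()) _ _

  module Simplification (_≟_ : DecidableEquality X) where
    open DecMembership _≟_ using (_∈?_)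

    suffixFrom : ∀ {x y z} (w : Walk A y z) → x ∈ vertices w → Unique (vertices w) → SimpleWalk x z (vertices w)
    suffixFrom here       (here refl) unique = here , unique , λ v → v
    suffixFrom (step a w) (here refl) unique = step a w , unique , λ v → v
    suffixFrom (step a w) (there x∈)  (_ ∷ unique) with suffixFrom w x∈ unique
    ... | w′ , unique′ , ⊆w = w′ , unique′ , λ v → there (⊆w v)

    simplify : ∀ {x y} (w : Walk A x y) → SimpleWalk x y (vertices w)
    simplify here = here , [] ∷ [] , λ v → v
    simplify {x} (step a w) with simplify w
    ... | w′ , unique′ , ⊆w with x ∈? vertices w′
    ...   | yes x∈ = let (w″ , unique″ , ⊆w′) = suffixFrom w′ x∈ unique′
                     in w″ , unique″ , λ v → there (⊆w (⊆w′ v))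
    ...   | no  x∉ = step a w′ , ¬Any⇒All¬ _ x∉ ∷ unique′ ,
                     λ { (here e) → here e ; (there v) → there (⊆w v) }

  module Forest (A-sym : ∀ x y → A x y ≡ A y x) (acyclic : ∀ k → ¬ Cycle A k)
                (_≟_ : DecidableEquality X) where
    open Simplification _≟_

    neighbours-separated : ∀ {x₁ x₂ y} → A x₁ y ≡ true → A x₂ y ≡ true → x₁ ≢ x₂ →
      (w : Walk A x₁ x₂) → ¬ All (_≢ y) (vertices w)
    neighbours-separated {x₁} {y = y} a₁ a₂ x₁≢x₂ w avoids with simplify w
    ... | here , _ , _ = x₁≢x₂ refl
    ... | w′@(step _ _) , unique , ⊆w =
      let (k , cycle) = closeCycle (step (trans (A-sym y x₁) a₁) w′) (s≤s (s≤s z≤n))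
                          (All.map (λ v≢y y≡v → v≢y (sym y≡v)) (anti-mono ⊆w avoids) ∷ unique) a₂
      in acyclic k cycle

  module Reachability (_≟_ : DecidableEquality X) (∃? : ∀ {P : X → Set} → Decidable P → Dec (∃ P)) where

    WalkWithin : ℕ → X → X → Set
    WalkWithin t x y = Σ (Walk A x y) λ w → length w ≤ t

    walkWithin? : ∀ t x y → Dec (WalkWithin t x y)
    walkWithin? zero x y with x ≟ y
    ... | yes refl = yes (here , z≤n)
    ... | no  x≢y  = no λ { (here , _) → x≢y refl ; (step _ _ , ()) }
    walkWithin? (suc t) x y with x ≟ y | ∃? (λ z → (A x z Boolₚ.≟ true) ×-dec walkWithin? t z y)
    ... | yes refl | _                      = yes (here , z≤n)
    ... | no _     | yes (_ , a , w , w≤t)  = yes (step a w , s≤s w≤t)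
    ... | no  x≢y  | no ∄                   =
      no λ { (here , _) → x≢y refl ; (step a w , s≤s w≤t) → ∄ (_ , a , w , w≤t) }

    module Depth (N : ℕ) where

      -- Opaque because unfolding the search during conversion checking is prohibitively slow.
      opaque
        depth : X → X → ℕ
        depth ρ z = least (λ t → does (walkWithin? t z ρ)) N

        depth-walk : ∀ {ρ z} → WalkWithin N z ρ → WalkWithin (depth ρ z) z ρ
        depth-walk {ρ} {z} (w , w≤N) =
          does⇒ (walkWithin? _ z ρ) (least-holds (λ t → does (walkWithin? t z ρ)) N w≤N
            (dec-true (walkWithin? _ z ρ) (w , ≤-refl)))

        depth-minimal : ∀ {ρ z} (w : Walk A z ρ) → length w ≤ N → depth ρ z ≤ length w
        depth-minimal {ρ} {z} w w≤N = least-minimal _ N (dec-true (walkWithin? (length w) z ρ) (w , ≤-refl))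

        depth≤N : ∀ ρ z → depth ρ z ≤ N
        depth≤N ρ z = least≤ _ N

      depth-along : ∀ {ρ z} (w : Walk A z ρ) → length w ≤ N → All (λ v → depth ρ v ≤ length w) (vertices w)
      depth-along here       w≤N = depth-minimal here w≤N ∷ []
      depth-along (step a w) w≤N = depth-minimal (step a w) w≤N ∷
        All.map (λ d≤w → ≤-trans d≤w (n≤1+n _)) (depth-along w (≤-trans (n≤1+n _) w≤N))

      descent : ∀ {ρ z} → WalkWithin N z ρ →
        Σ (Walk A z ρ) λ w → All (λ v → v ≡ z ⊎ depth ρ v < depth ρ z) (vertices w)
      descent reach with depth-walk reach
      ... | here , _ = here , inj₁ refl ∷ []
      ... | step a w , w<depth = step a w , inj₁ refl ∷
        All.map (λ d≤w → inj₂ (≤-<-trans d≤w w<depth))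
          (depth-along w (≤-trans (n≤1+n _) (≤-trans w<depth (depth≤N _ _))))

module Construction (m : ℕ) {V : Set} (F : Fin (suc m) → Fin (suc m) → V)
  (uniform : Uniform F) (linear : Linear F)
  (A : GV (suc m) → GV (suc m) → Bool) (trees : IdentifierTrees F A) where

  n : ℕ
  n = suc m

  X : Set
  X = GV n

  A-sym : ∀ x y → A x y ≡ A y x
  A-sym = proj₁ trees

  A-irrefl : ∀ x → A x x ≡ false
  A-irrefl = proj₁ (proj₂ trees)

  A⇒sameLabel : ∀ x y → A x y ≡ true → label F x ≡ label F y
  A⇒sameLabel = proj₁ (proj₂ (proj₂ trees))

  sameLabel⇒walk : ∀ x y → label F x ≡ label F y → Walk A x y
  sameLabel⇒walk = proj₁ (proj₂ (proj₂ (proj₂ trees)))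

  acyclic : ∀ k → ¬ Cycle A k
  acyclic = proj₂ (proj₂ (proj₂ (proj₂ trees)))

  A⇒≢ : ∀ {x y} → A x y ≡ true → x ≢ y
  A⇒≢ {x} a refl = contradiction (trans (sym (A-irrefl x)) a) λ ()

  _≟X_ : DecidableEquality X
  _≟X_ = ≡-dec Finₚ._≟_ Finₚ._≟_

  ∃X? : ∀ {P : X → Set} → Decidable P → Dec (∃ P)
  ∃X? P? = map′ (λ (i , j , p) → (i , j) , p) (λ ((i , j) , p) → i , j , p)
    (Finₚ.any? λ i → Finₚ.any? λ j → P? (i , j))

  allX : List X
  allX = cartesianProduct (allFin n) (allFin n)

  ∈allX : ∀ x → x ∈ allX
  ∈allX (i , j) = ∈-cartesianProduct⁺ (∈-allFin i) (∈-allFin j)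

  index : X → Fin (n * n)
  index (i , j) = combine i j

  index-injective : Injective _≡_ _≡_ index
  index-injective {i , j} {k , l} eq = let (i≡k , j≡l) = Finₚ.combine-injective i j k l eq in cong₂ _,_ i≡k j≡l

  open WalkProperties A
  open Reverse A-sym
  open Simplification _≟X_
  open Forest A-sym acyclic _≟X_
  open Reachability _≟X_ ∃X?
  open Depth (n * n)
  open CyclicDistance n

  _~_ : X → X → Set
  x ~ y = label F x ≡ label F y

  walk⇒~ : ∀ {x y} → Walk A x y → x ~ y
  walk⇒~ here       = refl
  walk⇒~ (step a w) = trans (A⇒sameLabel _ _ a) (walk⇒~ w)

  ~⇒walkWithin : ∀ {x y} → x ~ y → WalkWithin (n * n) x y
  ~⇒walkWithin {x} {y} x~y = let (w , unique , _) = simplify (sameLabel⇒walk x y x~y)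
                             in w , <⇒≤ (length< index index-injective w unique)

  _~?_ : ∀ x y → Dec (x ~ y)
  x ~? y = map′ (λ (w , _) → walk⇒~ w) ~⇒walkWithin (walkWithin? (n * n) x y)

  ~-sameClique : ∀ {x y} → x ~ y → proj₁ x ≡ proj₁ y → x ≡ y
  ~-sameClique {i , a} {.i , b} x~y refl = cong (i ,_) (uniform i x~y)

  clique : X → ℕ
  clique (i , _) = toℕ i

  clique<n : ∀ x → clique x < n
  clique<n (i , _) = Finₚ.toℕ<n i

  ~-clique-injective : ∀ {x y} → x ~ y → clique x ≡ clique y → x ≡ y
  ~-clique-injective x~y eq = ~-sameClique x~y (Finₚ.toℕ-injective eq)

  opaque
    classOf : X → List X
    classOf y = filter (_~? y) allX

    ∈classOf : ∀ {y z} → z ~ y → z ∈ classOf y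
    ∈classOf {y} {z} z~y = ∈-filter⁺ (_~? y) (∈allX z) z~y

    classOf-~ : ∀ y → All (_~ y) (classOf y)
    classOf-~ y = All.tabulate λ {z} z∈ → proj₂ (∈-filter⁻ (_~? y) {xs = allX} z∈)

  opaque
    root : Fin n → X → X
    root p y = argmin (λ z → dist (toℕ p) (clique z)) y (classOf y)

    root~ : ∀ p y → root p y ~ y
    root~ p y = argmin-all (λ z → dist (toℕ p) (clique z)) {P = _~ y} refl (classOf-~ y)

    root-minimal : ∀ p {y z} → z ~ y → dist (toℕ p) (clique (root p y)) ≤ dist (toℕ p) (clique z)
    root-minimal p {y} z~y =
      All.lookup (f[argmin]≤f[xs] {f = λ z → dist (toℕ p) (clique z)} y (classOf y)) (∈classOf z~y)

  root-cong : ∀ p {y y′} → y ~ y′ → root p y ≡ root p y′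
  root-cong p {y} {y′} y~y′ = ~-clique-injective r~r′
    (dist-injectiveʳ (Finₚ.toℕ<n p) (clique<n (root p y)) (clique<n (root p y′))
      (≤-antisym (root-minimal p (trans (root~ p y′) (sym y~y′)))
                 (root-minimal p (trans (root~ p y) y~y′))))
    where r~r′ = trans (root~ p y) (trans y~y′ (sym (root~ p y′)))

  Sibling : X → X → Set
  Sibling y z = z ~ y × proj₁ z ≢ proj₁ y

  sibling? : ∀ y z → Dec (Sibling y z)
  sibling? y z = (z ~? y) ×-dec ¬? (proj₁ z Finₚ.≟ proj₁ y)

  opaque
    siblingGaps : X → List ℕ
    siblingGaps y = map (λ z → dist (clique z) (clique y)) (filter (sibling? y) allX)

    siblingGaps⁺ : ∀ {y z} → Sibling y z → dist (clique z) (clique y) ∈ siblingGaps y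
    siblingGaps⁺ {y} {z} sib = ∈-map⁺ (λ z → dist (clique z) (clique y)) (∈-filter⁺ (sibling? y) (∈allX z) sib)

    siblingGaps⁻ : ∀ {y d} → d ∈ siblingGaps y → ∃ λ z → Sibling y z × d ≡ dist (clique z) (clique y)
    siblingGaps⁻ {y} d∈ = let (z , z∈ , d≡) = ∈-map⁻ (λ z → dist (clique z) (clique y)) d∈
                          in z , proj₂ (∈-filter⁻ (sibling? y) {xs = allX} z∈) , d≡

  opaque
    gap : X → ℕ
    gap y = min n (siblingGaps y)

    gap≤n : ∀ y → gap y ≤ n
    gap≤n y = min≤⊤ n (siblingGaps y)

    gap-minimal : ∀ {y z} → Sibling y z → gap y ≤ dist (clique z) (clique y)
    gap-minimal {y} sib = All.lookup (f[argmin]≤f[xs] {f = λ t → t} n (siblingGaps y)) (siblingGaps⁺ sib)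

    gap-witness : ∀ y → gap y < n → ∃ λ z → Sibling y z × dist (clique z) (clique y) ≡ gap y
    gap-witness y gap<n with argmin-sel (λ t → t) n (siblingGaps y)
    ... | inj₁ gap≡n = contradiction gap≡n (<⇒≢ gap<n)
    ... | inj₂ gap∈  = let (z , sib , gap≡) = siblingGaps⁻ gap∈ in z , sib , sym gap≡

    1≤gap : ∀ y → 1 ≤ gap y
    1≤gap y = v≤min⁺ (s≤s z≤n) (All.tabulate λ d∈ →
      let (z , (_ , other) , d≡) = siblingGaps⁻ d∈
      in subst (1 ≤_) (sym d≡) (n≢0⇒n>0 λ d≡0 → other (Finₚ.toℕ-injective (dist≡0⇒≡ (clique<n z) d≡0))))

  root-self : ∀ p y → dist (toℕ p) (clique y) < gap y → root p y ≡ y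
  root-self p y before-gap with proj₁ (root p y) Finₚ.≟ proj₁ y
  ... | yes same = ~-sameClique (root~ p y) same
  ... | no other = contradiction (gap-minimal (root~ p y , other)) (<⇒≱ (begin-strict
    dist (clique r) (clique y)                          ≤⟨ m≤n+m _ _ ⟩
    dist (toℕ p) (clique r) + dist (clique r) (clique y) ≡⟨ dist-split (Finₚ.toℕ<n p) (clique<n r) (clique<n y)
                                                            (root-minimal p refl) ⟩
    dist (toℕ p) (clique y)                             <⟨ before-gap ⟩
    gap y                                               ∎))
    where open ≤-Reasoning
          r = root p y

  gap-injective : ∀ i a b → gap (i , a) ≡ gap (i , b) → gap (i , a) < n → a ≡ b
  gap-injective i a b same gap<n =
    let (za , (za~a , ja≢i) , da) = gap-witness (i , a) gap<n
        (zb , (zb~b , jb≢i) , db) = gap-witness (i , b) (subst (_< n) same gap<n)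
        ja≡jb = Finₚ.toℕ-injective (dist-injectiveˡ (clique<n za) (clique<n zb) (Finₚ.toℕ<n i)
                  (trans da (trans same (sym db))))
    in linear i (proj₁ za) (λ i≡ja → ja≢i (sym i≡ja)) a b (proj₂ za) (proj₂ zb) (sym za~a)
         (trans (sym zb~b) (cong (λ j → F j (proj₂ zb)) (sym ja≡jb)))

  isRoot : Fin n → X → Bool
  isRoot p y = does (root p y ≟X y)

  gap≤roots : ∀ y → gap y ≤ countF (λ p → isRoot p y)
  gap≤roots y = ≤-trans
    (surjective⇒≤countF-< (λ p → dist (toℕ p) (clique y)) (gap y) onto)
    (countF-mono λ p before-gap → dec-true (root p y ≟X y) (root-self p y (does⇒ (_ <? gap y) before-gap)))
    where
    onto : ∀ t → t < gap y → ∃ λ p → dist (toℕ p) (clique y) ≡ t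
    onto t t<gap = let (a , a<n , dist≡t) = dist-surjectiveˡ (clique<n y) (<-≤-trans t<gap (gap≤n y))
                   in fromℕ< a<n , trans (cong (λ a → dist a (clique y)) (Finₚ.toℕ-fromℕ< a<n)) dist≡t

  module Rank = Precedence (×-strictTotalOrder <-strictTotalOrder (Finₚ.<-strictTotalOrder n))

  rankKey : Fin n → Fin n → ℕ × Fin n
  rankKey i a = gap (i , a) , a

  tournament : Fin n → Fin n → Fin n → Bool
  tournament i = Rank.precedes (rankKey i)

  tournament-transitive : ∀ i → TransitiveTournament (tournament i)
  tournament-transitive i = Rank.precedes-transitiveTournament (rankKey i) (λ a b (_ , a≡b) → a≡b)

  tournament-indegree : ∀ i b → countF (λ a → tournament i a b) ≤ gap (i , b) ∸ 1
  tournament-indegree i b with gap (i , b) <? n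
  ... | no gap≮n = subst (λ g → countF (λ a → tournament i a b) ≤ g ∸ 1)
    (≤-antisym (≮⇒≥ gap≮n) (gap≤n (i , b)))
    (countF-≤-missing (λ a → tournament i a b) b (Rank.precedes-irrefl (rankKey i) b))
  ... | yes gap<n = ≤-trans (countF-mono beats⇒lowerGap)
    (injective⇒countF-<≤pred (λ a → gap (i , a)) (gap (i , b)) (λ a → 1≤gap (i , a))
      (λ a a′ same lower → gap-injective i a a′ same (<-≤-trans lower (gap≤n (i , b)))))
    where
    beats⇒lowerGap : ∀ a → tournament i a b ≡ true → does (gap (i , a) <? gap (i , b)) ≡ true
    beats⇒lowerGap a a→b with Rank.precedes⇒≺ (rankKey i) a b a→b
    ... | inj₁ lower        = dec-true (gap (i , a) <? gap (i , b)) lower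
    ... | inj₂ (same , a<b) with gap-injective i a b same (subst (_< n) (sym same) gap<n)
    ...   | refl = contradiction a<b (Finₚ.<-irrefl refl)

  module Orient = Precedence (×-strictTotalOrder <-strictTotalOrder
    (×-strictTotalOrder (Finₚ.<-strictTotalOrder n) (Finₚ.<-strictTotalOrder n)))

  depthFrom : Fin n → X → ℕ
  depthFrom p x = depth (root p x) x

  orientationKey : Fin n → X → ℕ × X
  orientationKey p x = depthFrom p x , x

  oriented : Fin n → X → X → Bool
  oriented p = Orient.precedes (orientationKey p)

  orientation : X → X → Fin m → Bool
  orientation x y k = oriented (suc k) x y

  orientation-valid : ValidOrientation A orientation
  orientation-valid x y a k = Orient.precedes-flip (orientationKey (suc k)) x y
    (λ (_ , x₁≡y₁ , x₂≡y₂) → A⇒≢ a (cong₂ _,_ x₁≡y₁ x₂≡y₂))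

  oriented⇒depth≤ : ∀ p {x y} → A x y ≡ true → oriented p x y ≡ true → depth (root p y) x ≤ depth (root p y) y
  oriented⇒depth≤ p {x} {y} a x→y = subst (λ ρ → depth ρ x ≤ depth (root p y) y) (root-cong p (A⇒sameLabel x y a))
    (lex⇒≤ (Orient.precedes⇒≺ (orientationKey p) x y x→y))
    where lex⇒≤ : ∀ {d d′ : ℕ} {rest} → d < d′ ⊎ (d ≡ d′ × rest) → d ≤ d′
          lex⇒≤ (inj₁ d<d′)     = <⇒≤ d<d′
          lex⇒≤ (inj₂ (d≡d′ , _)) = ≤-reflexive d≡d′

  pathToRootAvoiding : ∀ p {x y} → A x y ≡ true → oriented p x y ≡ true →
    Σ (Walk A x (root p y)) λ w → All (_≢ y) (vertices w)
  pathToRootAvoiding p {x} {y} a x→y =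
    let (w , descending) = descent (~⇒walkWithin (trans (A⇒sameLabel x y a) (sym (root~ p y))))
    in w , All.map avoids descending
    where avoids : ∀ {v} → v ≡ x ⊎ depth (root p y) v < depth (root p y) x → v ≢ y
          avoids (inj₁ refl)  = A⇒≢ a
          avoids (inj₂ lower) refl = <-irrefl refl (<-≤-trans lower (oriented⇒depth≤ p a x→y))

  inNeighbour : Fin n → X → X → Bool
  inNeighbour p y x = A x y ∧ oriented p x y

  inNeighbour-unique : ∀ p y x₁ x₂ → inNeighbour p y x₁ ≡ true → inNeighbour p y x₂ ≡ true → x₁ ≡ x₂
  inNeighbour-unique p y x₁ x₂ in₁ in₂ with x₁ ≟X x₂
  ... | yes x₁≡x₂ = x₁≡x₂
  ... | no  x₁≢x₂ =
    let (a₁ , x₁→y) = ∧-true⁻ {A x₁ y} {oriented p x₁ y} in₁ ; (w₁ , avoids₁) = pathToRootAvoiding p a₁ x₁→y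
        (a₂ , x₂→y) = ∧-true⁻ {A x₂ y} {oriented p x₂ y} in₂ ; (w₂ , avoids₂) = pathToRootAvoiding p a₂ x₂→y
    in ⊥-elim (neighbours-separated a₁ a₂ x₁≢x₂ (w₁ ++ᵂ reverse w₂)
         (All-++ᵂ w₁ (reverse w₂) avoids₁ (All-reverse w₂ avoids₂)))

  root-noInNeighbour : ∀ p y x → root p y ≡ y → inNeighbour p y x ≡ false
  root-noInNeighbour p y x root≡y with inNeighbour p y x in in₁
  ... | false = refl
  ... | true  with ∧-true⁻ in₁
  ...   | a , x→y with depth-walk (~⇒walkWithin (trans (A⇒sameLabel x y a) (sym (root~ p y))))
  ...     | here , _ = contradiction root≡y (A⇒≢ a)
  ...     | step _ _ , step≤depth =
    contradiction (≤-trans step≤depth (≤-trans (oriented⇒depth≤ p a x→y) rootDepth)) λ ()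
    where rootDepth : depth (root p y) y ≤ 0
          rootDepth = subst (λ ρ → depth ρ y ≤ 0) (sym root≡y) (depth-minimal here z≤n)

  indegree : Fin n → X → ℕ
  indegree p y = sumF λ i → countF λ j → inNeighbour p y (i , j)

  isRoot+indegree≤1 : ∀ p y → indicator (isRoot p y) + indegree p y ≤ 1
  isRoot+indegree≤1 p y with root p y ≟X y
  ... | no _ = countF-pairs-≤1 (λ i j → inNeighbour p y (i , j))
    (λ i j i′ j′ → inNeighbour-unique p y (i , j) (i′ , j′))
  ... | yes root≡y = ≤-reflexive (cong suc (trans
    (sumF-cong λ i → trans (sumF-cong λ j → cong indicator (root-noInNeighbour p y (i , j) root≡y)) (sumF-zero n))
    (sumF-zero n)))

  idInDeg≡sumIndegree : ∀ y → idInDeg A orientation y ≡ sumF {m} (λ k → indegree (suc k) y)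
  idInDeg≡sumIndegree y = begin
    sumF (λ i → sumF (λ j → if A (i , j) y then countF (orientation (i , j) y) else 0))
      ≡⟨ sumF-cong (λ i → sumF-cong (λ j → perEdge (i , j))) ⟩
    sumF (λ i → sumF (λ j → countF (λ k → inNeighbour (suc k) y (i , j))))
      ≡⟨ sumF-cong (λ i → sumF-comm (λ j k → indicator (inNeighbour (suc k) y (i , j)))) ⟩
    sumF (λ i → sumF (λ k → countF (λ j → inNeighbour (suc k) y (i , j))))
      ≡⟨ sumF-comm (λ i k → countF (λ j → inNeighbour (suc k) y (i , j))) ⟩
    sumF (λ k → indegree (suc k) y) ∎
    where
    open ≡-Reasoning
    perEdge : ∀ x → (if A x y then countF (orientation x y) else 0) ≡ countF (λ k → inNeighbour (suc k) y x)
    perEdge x with A x y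
    ... | true  = refl
    ... | false = sym (sumF-zero m)

  gap∸1≤rootCopies : ∀ y → gap y ∸ 1 ≤ countF {m} (λ k → isRoot (suc k) y)
  gap∸1≤rootCopies y = ∸-monoˡ-≤ 1 (≤-trans (gap≤roots y) (+-monoˡ-≤ _ (indicator≤1 (isRoot zero y))))

  inDegree-bound : ∀ i b → countF (λ a → tournament i a b) + idInDeg A orientation (i , b) ≤ m
  inDegree-bound i b = begin
    countF (λ a → tournament i a b) + idInDeg A orientation y
      ≤⟨ +-mono-≤ (≤-trans (tournament-indegree i b) (gap∸1≤rootCopies y)) (≤-reflexive (idInDeg≡sumIndegree y)) ⟩
    countF (λ k → isRoot (suc k) y) + sumF (λ k → indegree (suc k) y)
      ≡⟨ sumF-distrib-+ (λ k → indicator (isRoot (suc k) y)) (λ k → indegree (suc k) y) ⟨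
    sumF (λ k → indicator (isRoot (suc k) y) + indegree (suc k) y)
      ≤⟨ sumF-mono-≤ (λ k → isRoot+indegree≤1 (suc k) y) ⟩
    sumF {m} (λ _ → 1)
      ≡⟨ sumF-one m ⟩
    m ∎
    where
    open ≤-Reasoning
    y = (i , b)

mainTheorem1 : (n : ℕ) → 1 ≤ n → {V : Set} → (F : Fin n → Fin n → V) →
    Uniform F → Linear F →
    (A : GV n → GV n → Bool) → IdentifierTrees F A →
    ∃[ dir ] (ValidOrientation A dir × VandermondeCompletable A dir)
mainTheorem1 (suc m) _ F uniform linear A trees =
  orientation , orientation-valid , tournament , tournament-transitive , inDegree-bound
  where open Construction m F uniform linear A trees
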